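{- Let $\Sigma$ and $\Pi$ be disjoint alphabets, let $t \in (\Sigma\cup\Pi)^n$, and consider the parameterized position heap $\mathrm{PPH}(t)$ with the positions stored in its nodes. If $j<n$ is a secondary position of a (double) node of $\mathrm{PPH}(t)$, then $j+1$ is also a secondary position.
   Context: $\Sigma$ (constant symbols) and $\Pi$ (parameter symbols) are disjoint sets; a p-string is a string over $\Sigma\cup\Pi$; $w[i:j]$ denotes a substring and $w[i:]=w[i:|w|]$. The prev-encoding $\mathrm{prev}(w)$ is the string $x$ of length $|w|$ over $\Sigma \cup \mathbb{N}$ with $x[i]=w[i]$ if $w[i]\in\Sigma$; $x[i]=0$ if $w[i]\in\Pi$ does not occur in $w[1:i-1]$; otherwise $x[i] = i - \max\{j<i : w[j]=w[i]\}$. Let $w_k = \mathrm{prev}(t[k:])$ for $k=1,\dots,n$. The parameterized position heap $\mathrm{PPH}(t)$ is the trie built by processing $k=1,\dots,n$ in order, starting from a single root node: let $p_k$ be the shortest prefix of $w_k$ that is not yet a node (nodes are identified with their root-to-node path labels); if $p_k$ exists, a new node $p_k$ is added as a child of $w_k[1:|p_k|-1]$ via an edge labeled $w_k[|p_k|]$, and position $k$ is stored in this new node as its primary position; if no such $p_k$ exists (i.e. $w_k$ is already a node), position $k$ is stored in the existing node $w_k$ as its secondary position. Every non-root node stores one or two positions; a node storing two positions (a primary and a secondary one) is called a double node. -}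

module Defs where

open import Data.Nat using (ℕ; zero; suc; _≤_; _<_)
open import Data.List using (List; []; _∷_; _++_; length; take; drop; map; upTo)
open import Data.List.Membership.Propositional using (_∈_)
open import Data.List.Membership.DecPropositional using () renaming (_∈?_ to member?)
open import Data.List.Properties using () renaming (≡-dec to List-≡-dec)
open import Data.Maybe using (Maybe; just; nothing)
open import Data.Sum using (_⊎_; inj₁; inj₂)
open import Data.Sum.Properties using () renaming (≡-dec to ⊎-≡-dec)
import Data.Nat.Properties as ℕP
open import Relation.Binary.Definitions using (DecidableEquality)
open import Relation.Nullary using (yes; no)

-- Symbols of a p-string: inj₁ = constant symbol (from Σ = S), inj₂ = parameter
-- symbol (from Π = P).  Disjointness of Σ and Π is built into the sum type.
-- Positions in strings are 1-based as in the paper.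

module PPH {S P : Set} (_≟S_ : DecidableEquality S) (_≟P_ : DecidableEquality P) where

  Sym : Set
  Sym = S ⊎ P

  -- Letters of prev-encoded strings: Σ ∪ ℕ
  Code : Set
  Code = S ⊎ ℕ

  _≟C_ : DecidableEquality Code
  _≟C_ = ⊎-≡-dec _≟S_ ℕP._≟_

  _≟L_ : DecidableEquality (List Code)
  _≟L_ = List-≡-dec _≟C_

  -- dist p hist: hist is the already-read prefix in REVERSE order;
  -- returns i - max{j<i : w[j] = p} if p occurred, nothing otherwise.
  dist : P → List Sym → Maybe ℕ
  dist p [] = nothing
  dist p (inj₁ _ ∷ h) = Data.Maybe.map suc (dist p h)
  dist p (inj₂ q ∷ h) with p ≟P q
  ... | yes _ = just 1
  ... | no  _ = Data.Maybe.map suc (dist p h)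

  prevGo : List Sym → List Sym → List Code
  prevGo hist [] = []
  prevGo hist (inj₁ a ∷ w) = inj₁ a ∷ prevGo (inj₁ a ∷ hist) w
  prevGo hist (inj₂ p ∷ w) with dist p hist
  ... | nothing = inj₂ 0 ∷ prevGo (inj₂ p ∷ hist) w
  ... | just d  = inj₂ d ∷ prevGo (inj₂ p ∷ hist) w

  prev : List Sym → List Code
  prev w = prevGo [] w

  -- t[k:] for 1-based k
  suffixFrom : List Sym → ℕ → List Sym
  suffixFrom t zero    = t
  suffixFrom t (suc k) = drop k t

  wk : List Sym → ℕ → List Code
  wk t k = prev (suffixFrom t k)

  prefixes : List Code → List (List Code)
  prefixes w = map (λ i → take i w) (upTo (suc (length w)))

  firstNew : List (List Code) → List (List Code) → Maybe (List Code)
  firstNew N [] = nothing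
  firstNew N (x ∷ xs) with member? _≟L_ x N
  ... | yes _ = firstNew N xs
  ... | no  _ = just x

  -- one step of the construction: add p_k (the shortest prefix of w_k that is
  -- not yet a node) if it exists; nodes are identified with their path labels
  step : List (List Code) → List Code → List (List Code)
  step N w with firstNew N (prefixes w)
  ... | nothing = N
  ... | just p  = p ∷ N

  nodesAfter : List Sym → ℕ → List (List Code)
  nodesAfter t zero    = [] ∷ []
  nodesAfter t (suc m) = step (nodesAfter t m) (wk t (suc m))

  -- position k (1 ≤ k ≤ n) is stored as a secondary position in PPH(t):
  -- when processing k, w_k is already a node (so no p_k exists)
  SecondaryPos : List Sym → ℕ → Set
  SecondaryPos t zero    = Data.Empty.⊥
    where import Data.Empty
  SecondaryPos t (suc m) = (suc m ≤ length t) × (wk t (suc m) ∈ nodesAfter t m)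
    where open import Data.Product using (_×_)

module Submission where

-- For a prev-encoded string x let  suffixLink x  be the encoding
-- obtained by deleting the first letter: the remaining codes are kept, except
-- that a code pointing exactly at the deleted letter becomes 0.  Then
--   (1) suffixLink (prev v) ≡ prev (v without its first symbol), hence
--       suffixLink w_k ≡ w_(k+1), and suffixLink commutes with prefixes.
--   (2) Every node set produced by the construction is prefix-closed, and a
--       step processing w adds take (r+1) w whenever take r w is a node.
--   (3) Suffix-link closure: if x is a node after processing positions
--       1..i, then suffixLink x is a node after processing 1..i+1.  A node
--       created at step i is a prefix of w_i all of whose shorter prefixes
--       were nodes; its link is a prefix of w_(i+1) whose parent is a node by
--       induction, so step i+1 creates it if it is not already present.
-- The theorem follows: if j is secondary then w_j is a node after step j-1,
-- so w_(j+1) = suffixLink w_j is a node after step j, i.e. j+1 is secondary.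

open import Defs
open import Data.Nat using (ℕ; zero; suc; _+_; _<_; _≤_; z≤n; s≤s)
open import Data.Nat.Properties
  using (m≤n⇒m⊓n≡m; m≥n⇒m⊓n≡n; <-irrefl; ≮⇒≥; _<?_; <⇒≤; m≤n⇒m≤1+n; ≤-refl; +-comm)
  renaming (_≟_ to _≟ℕ_)
open import Data.List using (List; []; _∷_; _++_; length; take; drop; applyUpTo)
open import Data.List.Properties using (take-take; take-all; take-[]; map-upTo; drop-drop)
open import Data.List.Membership.Propositional using (_∈_)
open import Data.List.Relation.Unary.Any using (here; there)
open import Data.List.Membership.DecPropositional using () renaming (_∈?_ to member?)
open import Data.Maybe using (just; nothing)
open import Data.Maybe.Properties using (just-injective)
open import Data.Sum using (_⊎_; inj₁; inj₂)
open import Data.Product using (Σ; _×_; _,_)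
open import Data.Empty using (⊥-elim)
open import Relation.Binary.Definitions using (DecidableEquality)
open import Relation.Binary.PropositionalEquality
open import Relation.Nullary using (yes; no; ¬_)
open import Function using (_∘_)

take-shorter : ∀ {A : Set} {k s} (w : List A) → k ≤ s → take k (take s w) ≡ take k w
take-shorter {k = k} {s} w k≤s = trans (take-take k s w) (cong (λ z → take z w) (m≤n⇒m⊓n≡m k≤s))

take-longer : ∀ {A : Set} {k s} (w : List A) → s ≤ k → take k (take s w) ≡ take s w
take-longer {k = k} {s} w s≤k = trans (take-take k s w) (cong (λ z → take z w) (m≥n⇒m⊓n≡n s≤k))

module _ {S P : Set} (_≟S_ : DecidableEquality S) (_≟P_ : DecidableEquality P) where
  open PPH _≟S_ _≟P_

  -- A parameter code d sitting at position k of the shortened string points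
  -- at the deleted letter iff d ≡ k; such a code becomes 0.
  unlink : ℕ → ℕ → Code
  unlink k d with k ≟ℕ d
  ... | yes _ = inj₂ 0
  ... | no  _ = inj₂ d

  unlink-zero : ∀ k → unlink k 0 ≡ inj₂ 0
  unlink-zero k with k ≟ℕ 0
  ... | yes _ = refl
  ... | no  _ = refl

  unlink-self : ∀ k → unlink k k ≡ inj₂ 0
  unlink-self k with k ≟ℕ k
  ... | yes _  = refl
  ... | no k≢k = ⊥-elim (k≢k refl)

  unlink-below : ∀ {k d} → d < k → unlink k d ≡ inj₂ d
  unlink-below {k} {d} d<k with k ≟ℕ d
  ... | yes refl = ⊥-elim (<-irrefl refl d<k)
  ... | no  _    = refl

  -- unlinkFrom k x: apply unlink to x, whose first letter is at position k.
  unlinkFrom : ℕ → List Code → List Code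
  unlinkFrom k []           = []
  unlinkFrom k (inj₁ a ∷ x) = inj₁ a ∷ unlinkFrom (suc k) x
  unlinkFrom k (inj₂ d ∷ x) = unlink k d ∷ unlinkFrom (suc k) x

  suffixLink : List Code → List Code
  suffixLink []      = []
  suffixLink (_ ∷ x) = unlinkFrom 1 x

  -- Unlinking acts letterwise, so it commutes with taking prefixes.
  unlinkFrom-take : ∀ k s x → unlinkFrom k (take s x) ≡ take s (unlinkFrom k x)
  unlinkFrom-take k zero    x            = refl
  unlinkFrom-take k (suc s) []           = refl
  unlinkFrom-take k (suc s) (inj₁ a ∷ x) = cong (inj₁ a ∷_) (unlinkFrom-take (suc k) s x)
  unlinkFrom-take k (suc s) (inj₂ d ∷ x) = cong (unlink k d ∷_) (unlinkFrom-take (suc k) s x)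

  suffixLink-take : ∀ s w → suffixLink (take (suc s) w) ≡ take s (suffixLink w)
  suffixLink-take s []      = sym (take-[] s)
  suffixLink-take s (_ ∷ x) = unlinkFrom-take 1 s x

  -- Appending an older symbol a to the (reversed) history h: an occurrence
  -- of p found in h is unaffected, and a new one can only be a itself.
  dist-snoc-found : ∀ p a h {d} → dist p h ≡ just d → dist p (h ++ a ∷ []) ≡ just d
  dist-snoc-found p a (inj₁ b ∷ h) e with dist p h in e'
  ... | just _ with refl ← e rewrite dist-snoc-found p a h e' = refl
  dist-snoc-found p a (inj₂ q ∷ h) e with p ≟P q
  ... | yes _ = e
  ... | no  _ with dist p h in e'
  ...   | just _ with refl ← e rewrite dist-snoc-found p a h e' = refl

  dist-snoc-new : ∀ p a h {d} → dist p h ≡ nothing → dist p (h ++ a ∷ []) ≡ just d →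
                  d ≡ suc (length h)
  dist-snoc-new p (inj₁ b) [] _ ()
  dist-snoc-new p (inj₂ q) [] _ e with p ≟P q
  dist-snoc-new p (inj₂ q) [] _ refl | yes _ = refl
  dist-snoc-new p (inj₂ q) [] _ ()   | no  _
  dist-snoc-new p a (inj₁ b ∷ h) e₁ e₂ with dist p h in e₁' | dist p (h ++ a ∷ []) in e₂'
  ... | nothing | just _ with refl ← e₂ = cong suc (dist-snoc-new p a h e₁' e₂')
  dist-snoc-new p a (inj₂ q ∷ h) e₁ e₂ with p ≟P q
  ... | no _ with dist p h in e₁' | dist p (h ++ a ∷ []) in e₂'
  ...   | nothing | just _ with refl ← e₂ = cong suc (dist-snoc-new p a h e₁' e₂')

  dist-bound : ∀ p h {d} → dist p h ≡ just d → d ≤ length h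
  dist-bound p (inj₁ b ∷ h) e with dist p h in e'
  ... | just _ with refl ← e = s≤s (dist-bound p h e')
  dist-bound p (inj₂ q ∷ h) e with p ≟P q
  ... | yes _ with refl ← e = s≤s z≤n
  ... | no  _ with dist p h in e'
  ...   | just _ with refl ← e = s≤s (dist-bound p h e')

  prevGo-forget-oldest : ∀ a h u →
    unlinkFrom (suc (length h)) (prevGo (h ++ a ∷ []) u) ≡ prevGo h u
  prevGo-forget-oldest a h [] = refl
  prevGo-forget-oldest a h (inj₁ b ∷ u) = cong (inj₁ b ∷_) (prevGo-forget-oldest a (inj₁ b ∷ h) u)
  prevGo-forget-oldest a h (inj₂ p ∷ u) with dist p h in e₁ | dist p (h ++ a ∷ []) in e₂
  ... | just d  | just d' = cong₂ _∷_ code (prevGo-forget-oldest a (inj₂ p ∷ h) u)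
    where
      code : unlink (suc (length h)) d' ≡ inj₂ d
      code rewrite just-injective (trans (sym e₂) (dist-snoc-found p a h e₁)) =
        unlink-below (s≤s (dist-bound p h e₁))
  ... | just d  | nothing with () ← trans (sym e₂) (dist-snoc-found p a h e₁)
  ... | nothing | just d' = cong₂ _∷_ code (prevGo-forget-oldest a (inj₂ p ∷ h) u)
    where
      code : unlink (suc (length h)) d' ≡ inj₂ 0
      code rewrite dist-snoc-new p a h e₁ e₂ = unlink-self (suc (length h))
  ... | nothing | nothing = cong₂ _∷_ (unlink-zero (suc (length h))) (prevGo-forget-oldest a (inj₂ p ∷ h) u)

  suffixLink-prev : ∀ v → suffixLink (prev v) ≡ prev (drop 1 v)
  suffixLink-prev []      = refl
  suffixLink-prev (inj₁ b ∷ u) = prevGo-forget-oldest (inj₁ b) [] u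
  suffixLink-prev (inj₂ p ∷ u) = prevGo-forget-oldest (inj₂ p) [] u

  suffixLink-wk : ∀ t m → suffixLink (wk t (suc m)) ≡ wk t (suc (suc m))
  suffixLink-wk t m = begin
    suffixLink (prev (drop m t))  ≡⟨ suffixLink-prev (drop m t) ⟩
    prev (drop 1 (drop m t))      ≡⟨ cong prev (drop-drop m 1 t) ⟩
    prev (drop (m + 1) t)         ≡⟨ cong (λ k → prev (drop k t)) (+-comm m 1) ⟩
    prev (drop (suc m) t)         ∎
    where open ≡-Reasoning

  PrefixClosed : List (List Code) → Set
  PrefixClosed N = ∀ {x} → x ∈ N → ∀ k → take k x ∈ N

  firstNew-chooses : ∀ N (g : ℕ → List Code) m {p} → firstNew N (applyUpTo g m) ≡ just p →
    Σ ℕ λ k → p ≡ g k × (∀ s → s < k → g s ∈ N)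
  firstNew-chooses N g (suc m) e with member? _≟L_ (g 0) N
  ... | yes g0∈ with firstNew-chooses N (g ∘ suc) m e
  ...   | k , refl , earlier = suc k , refl , λ { zero _ → g0∈ ; (suc s) (s≤s s<k) → earlier s s<k }
  firstNew-chooses N g (suc m) refl | no _ = 0 , refl , λ _ ()

  firstNew-finds : ∀ N (g : ℕ → List Code) m k → (∀ s → s < k → g s ∈ N) → ¬ g k ∈ N →
    k < m → firstNew N (applyUpTo g m) ≡ just (g k)
  firstNew-finds N g (suc m) zero earlier gk∉ _ with member? _≟L_ (g 0) N
  ... | yes g0∈ = ⊥-elim (gk∉ g0∈)
  ... | no  _   = refl
  firstNew-finds N g (suc m) (suc k) earlier gk∉ (s≤s k<m) with member? _≟L_ (g 0) N
  ... | yes _   = firstNew-finds N (g ∘ suc) m k (λ s s<k → earlier (suc s) (s≤s s<k)) gk∉ k<m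
  ... | no g0∉  = ⊥-elim (g0∉ (earlier 0 (s≤s z≤n)))

  -- prefixes w, written as applyUpTo, to which the two lemmas above apply.
  firstNew-prefixes : ∀ N w → firstNew N (prefixes w) ≡ firstNew N (applyUpTo (λ i → take i w) (suc (length w)))
  firstNew-prefixes N w = cong (firstNew N) (map-upTo (λ i → take i w) (suc (length w)))

  step-mono : ∀ {N} w {x} → x ∈ N → x ∈ step N w
  step-mono {N} w x∈ with firstNew N (prefixes w)
  ... | nothing = x∈
  ... | just _  = there x∈

  step-adds : ∀ N w {p} → firstNew N (prefixes w) ≡ just p → step N w ≡ p ∷ N
  step-adds N w e with firstNew N (prefixes w)
  step-adds N w refl | just _ = refl

  step-cases : ∀ N w {x} → x ∈ step N w →
    x ∈ N ⊎ Σ ℕ λ s → x ≡ take s w × (∀ r → r < s → take r w ∈ N)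
  step-cases N w x∈ with firstNew N (prefixes w) in e
  ... | nothing = inj₁ x∈
  ... | just p with x∈
  ...   | here refl = inj₂ (firstNew-chooses N (λ i → take i w) (suc (length w))
                              (trans (sym (firstNew-prefixes N w)) e))
  ...   | there old = inj₁ old

  step-extends : ∀ {N} w {r} → PrefixClosed N → take r w ∈ N → take (suc r) w ∈ step N w
  step-extends {N} w {r} closed r∈ with member? _≟L_ (take (suc r) w) N
  ... | yes old = step-mono w old
  ... | no  new with r <? length w
  ...   | no  r≮ = ⊥-elim (new (subst (_∈ N) whole r∈))
    where
      whole : take r w ≡ take (suc r) w
      whole = trans (take-all r w (≮⇒≥ r≮)) (sym (take-all (suc r) w (m≤n⇒m≤1+n (≮⇒≥ r≮))))
  ...   | yes r< = subst (take (suc r) w ∈_) (sym (step-adds N w chosen)) (here refl)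
    where
      shorter : ∀ s → s < suc r → take s w ∈ N
      shorter s (s≤s s≤r) = subst (_∈ N) (take-shorter w s≤r) (closed r∈ s)
      chosen : firstNew N (prefixes w) ≡ just (take (suc r) w)
      chosen = trans (firstNew-prefixes N w)
                 (firstNew-finds N (λ i → take i w) (suc (length w)) (suc r) shorter new (s≤s r<))

  step-prefixClosed : ∀ {N} w → PrefixClosed N → PrefixClosed (step N w)
  step-prefixClosed {N} w closed x∈ k with step-cases N w x∈
  ... | inj₁ old = step-mono w (closed old k)
  ... | inj₂ (s , refl , shorter) with k <? s
  ...   | yes k<s = step-mono w (subst (_∈ N) (sym (take-shorter w (<⇒≤ k<s))) (shorter k k<s))
  ...   | no  k≮s = subst (_∈ step N w) (sym (take-longer w (≮⇒≥ k≮s))) x∈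

  module _ (t : List Sym) where

    root : ∀ i → [] ∈ nodesAfter t i
    root zero    = here refl
    root (suc i) = step-mono _ (root i)

    prefixClosed : ∀ i → PrefixClosed (nodesAfter t i)
    prefixClosed zero (here refl) k = here (take-[] k)
    prefixClosed (suc i) = step-prefixClosed _ (prefixClosed i)

    suffixLink-closed : ∀ i {x} → x ∈ nodesAfter t i → suffixLink x ∈ nodesAfter t (suc i)
    suffixLink-closed zero (here refl) = root 1
    suffixLink-closed (suc i) x∈ with step-cases _ (wk t (suc i)) x∈
    ... | inj₁ old = step-mono _ (suffixLink-closed i old)
    ... | inj₂ (zero , refl , _) = root (suc (suc i))
    ... | inj₂ (suc s , refl , shorter) = subst (_∈ nodesAfter t (suc (suc i))) (sym (link s)) (grow s shorter)
      where
        link : ∀ s → suffixLink (take (suc s) (wk t (suc i))) ≡ take s (wk t (suc (suc i)))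
        link s = trans (suffixLink-take s (wk t (suc i))) (cong (take s) (suffixLink-wk t i))

        grow : ∀ s → (∀ r → r < suc s → take r (wk t (suc i)) ∈ nodesAfter t i) →
               take s (wk t (suc (suc i))) ∈ nodesAfter t (suc (suc i))
        grow zero _ = root (suc (suc i))
        grow (suc s) shorter = step-extends _ (prefixClosed (suc i)) parent
          where
            parent : take s (wk t (suc (suc i))) ∈ nodesAfter t (suc i)
            parent = subst (_∈ nodesAfter t (suc i)) (link s)
                       (suffixLink-closed i (shorter (suc s) ≤-refl))

mainTheorem2 : {S P : Set} (_≟S_ : DecidableEquality S) (_≟P_ : DecidableEquality P)
    (t : List (S ⊎ P)) (j : ℕ) → j < length t →
    PPH.SecondaryPos _≟S_ _≟P_ t j → PPH.SecondaryPos _≟S_ _≟P_ t (suc j)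
mainTheorem2 ≟S ≟P t zero    _ ()
mainTheorem2 ≟S ≟P t (suc m) j<n (_ , wj∈) =
  j<n , subst (_∈ PPH.nodesAfter ≟S ≟P t (suc m)) (suffixLink-wk ≟S ≟P t m)
          (suffixLink-closed ≟S ≟P t m wj∈)
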